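{- For every integer $r\ge 2$, as $n\to\infty$, $$ex_3(n,\mathbb{B}_2^3S_r)\le (1+o(1))\frac{n^2}{4}.$$
   Context: $S_r$ denotes the star with $r$ edges. A $3$-uniform hypergraph consists of a finite vertex set and a set of distinct $3$-element subsets (hyperedges). A $3$-uniform hypergraph $\mathcal{F}$ is a $2$-wise Berge copy of a graph $F$ if $|E(\mathcal{F})|=2|E(F)|$ and there exist an injection $i:V(F)\to V(\mathcal{F})$ and a map $h$ assigning to each edge $e$ of $F$ a set $h(e)$ of $2$ hyperedges of $\mathcal{F}$ such that $h(e)\cap h(e')=\emptyset$ for distinct edges $e,e'$, and for every edge $e=xy$ of $F$, $\{i(x),i(y)\}\subseteq A$ for both $A\in h(e)$. $\mathbb{B}_2^3F$ is the family of such copies. $ex_3(n,\mathbb{F})$ is the maximum number of hyperedges in a $3$-uniform hypergraph on $n$ vertices containing no member of $\mathbb{F}$ as a subhypergraph. -}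

module Defs where

open import Data.Nat using (ℕ; suc; _<_)
open import Data.Fin using (Fin; toℕ; zero; suc)
open import Data.Product using (Σ; _×_; _,_; ∃-syntax)
open import Data.Sum using (_⊎_)
open import Data.List using (List)
open import Data.List.Relation.Unary.All using (All)
open import Data.List.Relation.Unary.Unique.Propositional using (Unique)
open import Data.List.Membership.Propositional using (_∈_)
open import Relation.Binary.PropositionalEquality using (_≡_)
open import Function.Definitions using (Injective)

-- A triple (a , b , c) of vertices of Fin n, read as the 3-set {a,b,c}.
Triple : ℕ → Set
Triple n = Fin n × Fin n × Fin n

-- Canonical form of a 3-element subset: strictly increasing coordinates.
Increasing : ∀ {n} → Triple n → Set
Increasing (a , b , c) = (toℕ a < toℕ b) × (toℕ b < toℕ c)

record Hypergraph3 (n : ℕ) : Set where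
  field
    edges      : List (Triple n)
    canonical  : All Increasing edges
    distinct   : Unique edges
open Hypergraph3 public

_∈ₜ_ : ∀ {n} → Fin n → Triple n → Set
v ∈ₜ (a , b , c) = (v ≡ a) ⊎ (v ≡ b) ⊎ (v ≡ c)

-- The star S_r: vertex set Fin (suc r), centre zero, leaves suc j;
-- edge j (j : Fin r) is {zero , suc j}.
-- H contains a 2-wise Berge copy of S_r: an injection i of the vertices
-- of S_r into V(H) and a map h assigning to each edge j of S_r two
-- hyperedges h j 0, h j 1 of H, all 2r of them pairwise distinct
-- (so the sets h(e) have size 2 and are pairwise disjoint), such that
-- both endpoints of edge j are in each of h j 0, h j 1.
-- The hyperedges {h j k} form the subhypergraph which is the copy.
ContainsBerge2Star : ∀ {n} → ℕ → Hypergraph3 n → Set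
ContainsBerge2Star {n} r H =
  Σ (Fin (suc r) → Fin n) λ i →
  Σ (Fin r × Fin 2 → Triple n) λ h →
    Injective _≡_ _≡_ i ×
    Injective _≡_ _≡_ h ×
    (∀ jk → h jk ∈ edges H) ×
    (∀ j k → (i zero ∈ₜ h (j , k)) × (i (suc j) ∈ₜ h (j , k)))

module Submission where

-- Call a pair of vertices heavy if at least two hyperedges contain it, and let D_v be the set of u ≠ v
-- with vu heavy; give each u ∈ D_v two hyperedges through vu. Such a hyperedge is {v, u, w} for one w,
-- so u clashes with at most two other members of D_v, and greedily one finds |D_v|/3 members whose
-- chosen hyperedges are pairwise distinct: a 2-wise Berge star centred at v. Without a copy of S_r,
-- therefore, |D_v| < K := 3r for every v. Now every hyperedge either has two heavy pairs meeting at some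
-- w, and is then fixed by w and two elements of D_w, or has two light pairs, each lying in no other
-- hyperedge. This injects (hyperedges) × 4 into (ordered pairs) ⊎ (n · 3 · K · K · 4 codes), so
-- 4|E| ≤ n² + 12K²n, which is at most (1 + 1/k) n² once n ≥ 12kK².

open import Defs
open import Data.Nat using (ℕ; suc; _≤_; _<_; _+_; _*_; z≤n; s≤s)
open import Data.Nat.Properties
  using (≤-refl; ≤-reflexive; ≤-trans; <-trans; ≤-pred; <⇒≢; ≰⇒>; <⇒≤; _≤?_; +-suc; *-suc; +-mono-≤;
         +-monoʳ-≤; *-monoʳ-≤; *-monoˡ-≤; *-cancelˡ-≤; m⊓n≤m; m≤n⇒m⊓n≡m; module ≤-Reasoning)
open import Data.Nat.Solver using (module +-*-Solver)
open import Data.Fin using (Fin; zero; suc; toℕ; punchOut; inject≤; _≟_)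
open import Data.Fin.Patterns using (0F; 1F; 2F; 3F)
open import Data.Fin.Properties using (punchOut-injective; inject≤-injective; injective⇒≤; +↔⊎; *↔×)
open import Data.Product.Properties using (≡-dec)
open import Data.Product using (∃-syntax; _×_; _,_; proj₁; proj₂; swap)
open import Data.Sum using (_⊎_; inj₁; inj₂)
open import Data.Sum.Properties using (inj₁-injective)
open import Data.Sum.Function.Propositional using (_⊎-↔_)
open import Data.Product.Function.NonDependent.Propositional using (_×-↔_)
open import Relation.Nullary.Decidable using (_×-dec_; _⊎-dec_)
open import Data.List using (List; []; _∷_; length; filter; lookup; take; allFin)
open import Data.List.Properties using (length-filter; length-take; filter-≐)
open import Data.List.Relation.Unary.All as All using (All; _∷_)
open import Data.List.Relation.Unary.All.Properties using (all-filter) renaming (filter⁺ to All-filter⁺)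
open import Data.List.Relation.Unary.Any as Any using (Any; here; there)
open import Data.List.Relation.Unary.Any.Properties using (lookup-index)
open import Data.List.Relation.Unary.AllPairs using (AllPairs; []; _∷_)
open import Data.List.Relation.Unary.Unique.Propositional using (Unique)
open import Data.List.Relation.Unary.Unique.Propositional.Properties using (filter⁺; take⁺; allFin⁺)
open import Data.List.Relation.Binary.Subset.Propositional using (_⊆_)
open import Data.List.Relation.Binary.Sublist.Propositional using () renaming (lookup to ⊆-lookup)
open import Data.List.Relation.Binary.Sublist.Propositional.Properties using (take-⊆)
open import Data.List.Membership.DecPropositional using (_∈?_)
open import Data.List.Membership.Propositional using (_∈_; lose; find)
open import Data.List.Membership.Setoid.Properties using (index-injective)
open import Data.List.Membership.Propositional.Properties using (∈-lookup; ∈-filter⁺; ∈-filter⁻; ∈-allFin)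
open import Relation.Binary.Definitions using (Symmetric)
open import Relation.Binary.PropositionalEquality using (setoid; _≡_; _≢_; refl; sym; trans; cong; subst; ≢-sym)
open import Relation.Nullary using (¬_; Dec; yes; no; ¬?; contradiction)
open import Relation.Unary using (Pred; Decidable)
open import Relation.Unary.Properties using (∁?)
open import Function using (_∘_; _∋_)
open import Level using (0ℓ)
open import Function.Definitions using (Injective)
open import Function.Bundles using (_↔_; mk↣; Injection)
open import Function.Properties.Inverse using (↔-refl; ↔-sym; ↔-trans; ↔⇒↣)
open import Function.Construct.Composition using (_↣-∘_)

module _ {A : Set} where

  AllPairs-lookup : ∀ {R : A → A → Set} → Symmetric R → ∀ {xs} → AllPairs R xs →
    ∀ {i j} → i ≢ j → R (lookup xs i) (lookup xs j)
  AllPairs-lookup R-sym (Rx ∷ _)   {zero}  {zero}  0≢0 = contradiction refl 0≢0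
  AllPairs-lookup R-sym (Rx ∷ _)   {zero}  {suc j} _   = All.lookup Rx (∈-lookup j)
  AllPairs-lookup R-sym (Rx ∷ _)   {suc i} {zero}  _   = R-sym (All.lookup Rx (∈-lookup i))
  AllPairs-lookup R-sym (_  ∷ Rxs) {suc i} {suc j} i≢j = AllPairs-lookup R-sym Rxs (i≢j ∘ cong suc)

  Unique-lookup-injective : ∀ {xs : List A} → Unique xs → Injective _≡_ _≡_ (lookup xs)
  Unique-lookup-injective uniq {i} {j} eq with i ≟ j
  ... | yes i≡j = i≡j
  ... | no i≢j  = contradiction eq (AllPairs-lookup ≢-sym uniq i≢j)

  length≤1⇒∈-unique : ∀ {xs : List A} {x y} → length xs ≤ 1 → x ∈ xs → y ∈ xs → x ≡ y
  length≤1⇒∈-unique {_ ∷ []}    _           (here refl) (here refl) = refl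
  length≤1⇒∈-unique {_ ∷ _ ∷ _} (s≤s ())    _           _

  Unique-covered⇒length≤ : ∀ {B : Set} {Q : B → A → Set} {xs ys} → Unique xs →
    (∀ {b x y} → Q b x → Q b y → x ≡ y) → All (λ x → Any (λ b → Q b x) ys) xs →
    length xs ≤ length ys
  Unique-covered⇒length≤ {Q = Q} {xs} {ys} uniq Q-functional covered = injective⇒≤ cover-injective
    where
    cover : ∀ i → Any (λ b → Q b (lookup xs i)) ys
    cover i = All.lookup covered (∈-lookup i)

    cover-injective : Injective _≡_ _≡_ (Any.index ∘ cover)
    cover-injective {i} {j} eq = Unique-lookup-injective uniq (Q-functional (lookup-index (cover i))
      (subst (λ k → Q (lookup ys k) (lookup xs j)) (sym eq) (lookup-index (cover j))))

  module _ {P : Pred A 0ℓ} (P? : Decidable P) where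

    length-filter+filter-∁ : ∀ xs → length (filter P? xs) + length (filter (∁? P?) xs) ≡ length xs
    length-filter+filter-∁ []       = refl
    length-filter+filter-∁ (x ∷ xs) with P? x
    ... | yes _ = cong suc (length-filter+filter-∁ xs)
    ... | no  _ = trans (+-suc _ _) (cong suc (length-filter+filter-∁ xs))

module _ {A : Set} {P : Pred A 0ℓ} {C : A → A → Set} (C? : ∀ u → Decidable (C u)) (C-sym : Symmetric C)
  {d : ℕ} (few-conflicts : ∀ {u xs} → P u → All P xs → Unique (u ∷ xs) → length (filter (C? u) xs) ≤ d)
  where

  large-independent-subset : ∀ xs → All P xs → Unique xs →
    ∃[ S ] AllPairs (λ a b → ¬ C a b) S × S ⊆ xs × length xs ≤ suc d * length S
  large-independent-subset xs = greedy (length xs) xs ≤-refl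
    where
    greedy : ∀ m xs → length xs ≤ m → All P xs → Unique xs →
      ∃[ S ] AllPairs (λ a b → ¬ C a b) S × S ⊆ xs × length xs ≤ suc d * length S
    greedy _       []       _          _          _              = [] , [] , (λ ()) , z≤n
    greedy (suc m) (u ∷ xs) (s≤s xs≤m) (Pu ∷ Pxs) uniq@(_ ∷ uxs)
      with greedy m (filter (∁? (C? u)) xs) (≤-trans (length-filter _ xs) xs≤m)
                    (All-filter⁺ (∁? (C? u)) Pxs) (filter⁺ (∁? (C? u)) uxs)
    ... | S , indep , S⊆ , xs≤S = u ∷ S , All.tabulate compatible ∷ indep , u∷S⊆ , size
      where
      compatible : ∀ {s} → s ∈ S → ¬ C u s
      compatible s∈S = proj₂ (∈-filter⁻ (∁? (C? u)) {xs = xs} (S⊆ s∈S))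

      u∷S⊆ : u ∷ S ⊆ u ∷ xs
      u∷S⊆ (here refl) = here refl
      u∷S⊆ (there s∈S) = there (proj₁ (∈-filter⁻ (∁? (C? u)) {xs = xs} (S⊆ s∈S)))

      size : suc (length xs) ≤ suc d * suc (length S)
      size = ≤-trans (s≤s (≤-trans (≤-reflexive (sym (length-filter+filter-∁ (C? u) xs)))
                                   (+-mono-≤ (few-conflicts Pu Pxs uniq) xs≤S)))
                     (≤-reflexive (sym (*-suc (suc d) (length S))))

Fin2-≢⇒≡ : ∀ {q x y : Fin 2} → x ≢ q → y ≢ q → x ≡ y
Fin2-≢⇒≡ {0F} {0F}      x≢q _   = contradiction refl x≢q
Fin2-≢⇒≡ {0F} {1F} {0F} _   y≢q = contradiction refl y≢q
Fin2-≢⇒≡ {0F} {1F} {1F} _   _   = refl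
Fin2-≢⇒≡ {1F} {0F} {0F} _   _   = refl
Fin2-≢⇒≡ {1F} {0F} {1F} _   y≢q = contradiction refl y≢q
Fin2-≢⇒≡ {1F} {1F}      x≢q _   = contradiction refl x≢q

Fin3-≢-pair⇒≡ : ∀ {p q x y : Fin 3} → p ≢ q → x ≢ p → x ≢ q → y ≢ p → y ≢ q → x ≡ y
Fin3-≢-pair⇒≡ {p} {q} p≢q x≢p x≢q y≢p y≢q =
  punchOut-injective (≢-sym x≢p) (≢-sym y≢p) (Fin2-≢⇒≡ (avoids x≢p x≢q) (avoids y≢p y≢q))
  where
  avoids : ∀ {z} (z≢p : z ≢ p) → z ≢ q → punchOut (≢-sym z≢p) ≢ punchOut p≢q
  avoids z≢p z≢q = z≢q ∘ punchOut-injective (≢-sym z≢p) p≢q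

vertex : ∀ {n} → Triple n → Fin 3 → Fin n
vertex (a , _ , _) 0F = a
vertex (_ , b , _) 1F = b
vertex (_ , _ , c) 2F = c

pattern ∈₁ = inj₁ refl
pattern ∈₂ = inj₂ (inj₁ refl)
pattern ∈₃ = inj₂ (inj₂ refl)

position : ∀ {n} {x : Fin n} (f : Triple n) → x ∈ₜ f → ∃[ p ] vertex f p ≡ x
position _ ∈₁ = 0F , refl
position _ ∈₂ = 1F , refl
position _ ∈₃ = 2F , refl

∈ₜ-third-unique : ∀ {n} (f : Triple n) {v u x y : Fin n} → v ∈ₜ f → u ∈ₜ f → x ∈ₜ f → y ∈ₜ f →
  v ≢ u → x ≢ v → x ≢ u → y ≢ v → y ≢ u → x ≡ y
∈ₜ-third-unique f v∈f u∈f x∈f y∈f v≢u x≢v x≢u y≢v y≢u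
  with position f v∈f | position f u∈f | position f x∈f | position f y∈f
... | pv , refl | pu , refl | px , refl | py , refl =
  cong (vertex f) (Fin3-≢-pair⇒≡ {pv} {pu} {px} {py} (v≢u ∘ cong (vertex f))
    (x≢v ∘ cong (vertex f)) (x≢u ∘ cong (vertex f)) (y≢v ∘ cong (vertex f)) (y≢u ∘ cong (vertex f)))

_∈ₜ?_ : ∀ {n} (v : Fin n) (f : Triple n) → Dec (v ∈ₜ f)
v ∈ₜ? (a , b , c) = (v ≟ a) ⊎-dec (v ≟ b) ⊎-dec (v ≟ c)

_≟ₜ_ : ∀ {n} (e f : Triple n) → Dec (e ≡ f)
_≟ₜ_ = ≡-dec _≟_ (≡-dec _≟_ _≟_)

Increasing⇒distinct : ∀ {n} {a b c : Fin n} → Increasing (a , b , c) → a ≢ b × a ≢ c × b ≢ c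
Increasing⇒distinct (a<b , b<c) =
  <⇒≢ a<b ∘ cong toℕ , <⇒≢ (<-trans a<b b<c) ∘ cong toℕ , <⇒≢ b<c ∘ cong toℕ

module _ {n : ℕ} (H : Hypergraph3 n) where

  Has : Fin n → Fin n → Triple n → Set
  Has s t f = s ∈ₜ f × t ∈ₜ f

  Has? : ∀ s t → Decidable (Has s t)
  Has? s t f = (s ∈ₜ? f) ×-dec (t ∈ₜ? f)

  through : Fin n → Fin n → List (Triple n)
  through s t = filter (Has? s t) (edges H)

  Heavy : Fin n → Fin n → Set
  Heavy s t = 2 ≤ length (through s t)

  Heavy-sym : ∀ {s t} → Heavy s t → Heavy t s
  Heavy-sym {s} {t} = subst (λ fs → 2 ≤ length fs) (filter-≐ (Has? s t) (Has? t s) (swap , swap) (edges H))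

  -- Stated through projections so that it unfolds at pairs that are not yet constructors, such as orient w x y i.
  LightPairOf : Triple n → Fin n × Fin n → Set
  LightPairOf e p = ¬ Heavy (proj₁ p) (proj₂ p) × Has (proj₁ p) (proj₂ p) e

  LightPairOf-swap : ∀ {e s t} → LightPairOf e (s , t) → LightPairOf e (t , s)
  LightPairOf-swap (light , st∈e) = light ∘ Heavy-sym , swap st∈e

  light-pair-determines-edge : ∀ {p e e'} → e ∈ edges H → e' ∈ edges H →
    LightPairOf e p → LightPairOf e' p → e ≡ e'
  light-pair-determines-edge {s , t} e∈H e'∈H (light , st∈e) (_ , st∈e') =
    length≤1⇒∈-unique (≤-pred (≰⇒> light))
      (∈-filter⁺ (Has? s t) e∈H st∈e) (∈-filter⁺ (Has? s t) e'∈H st∈e')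

  Good : Fin n → Fin n → Set
  Good v u = Heavy v u × u ≢ v

  Good? : ∀ v → Decidable (Good v)
  Good? v u = (2 ≤? length (through v u)) ×-dec ¬? (u ≟ v)

  Good-sym : ∀ {v u} → Good v u → Good u v
  Good-sym (vu-heavy , u≢v) = Heavy-sym vu-heavy , ≢-sym u≢v

  ¬Good⇒¬Heavy : ∀ {v u} → u ≢ v → ¬ Good v u → ¬ Heavy v u
  ¬Good⇒¬Heavy u≢v ¬good vu-heavy = ¬good (vu-heavy , u≢v)

  neighbours : Fin n → List (Fin n)
  neighbours v = filter (Good? v) (allFin n)

  module _ (v : Fin n) where

    chosen : Fin n → List (Triple n)
    chosen u = take 2 (through v u)

    chosen⊆edges : ∀ {u f} → f ∈ chosen u → f ∈ edges H × Has v u f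
    chosen⊆edges {u} = ∈-filter⁻ (Has? v u) ∘ ⊆-lookup (take-⊆ 2 (through v u))

    Conflict : Fin n → Fin n → Set
    Conflict u w = Any (_∈ chosen w) (chosen u)

    Conflict? : ∀ u → Decidable (Conflict u)
    Conflict? u w = Any.any? (λ f → _∈?_ _≟ₜ_ f (chosen w)) (chosen u)

    Conflict-sym : Symmetric Conflict
    Conflict-sym c with find c
    ... | f , f∈u , f∈w = lose f∈w f∈u

    chosenEdge : ∀ {u} → Heavy v u → Fin 2 → Triple n
    chosenEdge {u} heavy k = lookup (chosen u) (inject≤ k 2≤chosen)
      where
      2≤chosen : 2 ≤ length (chosen u)
      2≤chosen = ≤-reflexive (sym (trans (length-take 2 (through v u)) (m≤n⇒m⊓n≡m heavy)))

    chosenEdge-∈ : ∀ {u} (heavy : Heavy v u) k → chosenEdge heavy k ∈ chosen u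
    chosenEdge-∈ _ _ = ∈-lookup _

    chosenEdge-injective : ∀ {u} (heavy : Heavy v u) → Injective _≡_ _≡_ (chosenEdge heavy)
    chosenEdge-injective {u} _ =
      inject≤-injective _ _ _ _ ∘ Unique-lookup-injective (take⁺ 2 (filter⁺ (Has? v u) (distinct H)))

    Conflict-refl : ∀ {u} → Heavy v u → Conflict u u
    Conflict-refl heavy = lose (chosenEdge-∈ heavy 0F) (chosenEdge-∈ heavy 0F)

    conflicts≤2 : ∀ {u xs} → Good v u → All (Good v) xs → Unique (u ∷ xs) →
      length (filter (Conflict? u) xs) ≤ 2
    conflicts≤2 {u} {xs} (_ , u≢v) good (u∉xs ∷ uniq) =
      ≤-trans (Unique-covered⇒length≤ (filter⁺ (Conflict? u) uniq) third-unique
                                      (All.tabulate (witness ∘ ∈-filter⁻ (Conflict? u) {xs = xs})))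
              (subst (_≤ 2) (sym (length-take 2 (through v u))) (m⊓n≤m 2 _))
      where
      ThirdVertexOf : Triple n → Fin n → Set
      ThirdVertexOf f w = Has v u f × w ∈ₜ f × w ≢ v × w ≢ u

      third-unique : ∀ {f x y} → ThirdVertexOf f x → ThirdVertexOf f y → x ≡ y
      third-unique {f} ((v∈f , u∈f) , x∈f , x≢v , x≢u) (_ , y∈f , y≢v , y≢u) =
        ∈ₜ-third-unique f v∈f u∈f x∈f y∈f (≢-sym u≢v) x≢v x≢u y≢v y≢u

      witness : ∀ {w} → w ∈ xs × Conflict u w → Any (λ f → ThirdVertexOf f w) (chosen u)
      witness {w} (w∈xs , c) with find c
      ... | f , f∈u , f∈w =
        lose f∈u (proj₂ (chosen⊆edges f∈u) , proj₂ (proj₂ (chosen⊆edges f∈w)) ,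
                  proj₂ (All.lookup good w∈xs) , ≢-sym (All.lookup u∉xs w∈xs))

    independent-neighbours⇒star : ∀ r S → AllPairs (λ a b → ¬ Conflict a b) S → All (Good v) S →
      r ≤ length S → ContainsBerge2Star r H
    independent-neighbours⇒star r S independent good r≤S =
      centre-and-leaves , h , centre-and-leaves-injective , h-injective , h∈H , ends∈h
      where
      leaf : Fin r → Fin n
      leaf j = lookup S (inject≤ j r≤S)

      good-leaf : ∀ j → Good v (leaf j)
      good-leaf j = All.lookup good (∈-lookup _)

      independent-leaves : ∀ {j j'} → j ≢ j' → ¬ Conflict (leaf j) (leaf j')
      independent-leaves j≢j' =
        AllPairs-lookup (λ ¬c → ¬c ∘ Conflict-sym) independent (j≢j' ∘ inject≤-injective _ _ _ _)

      centre-and-leaves : Fin (suc r) → Fin n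
      centre-and-leaves zero    = v
      centre-and-leaves (suc j) = leaf j

      leaf-injective : Injective _≡_ _≡_ leaf
      leaf-injective {j} {j'} eq with j ≟ j'
      ... | yes j≡j' = j≡j'
      ... | no  j≢j' = contradiction (subst (Conflict (leaf j)) eq (Conflict-refl (proj₁ (good-leaf j))))
                                     (independent-leaves j≢j')

      centre-and-leaves-injective : Injective _≡_ _≡_ centre-and-leaves
      centre-and-leaves-injective {zero}  {zero}   _  = refl
      centre-and-leaves-injective {zero}  {suc j'} eq = contradiction (sym eq) (proj₂ (good-leaf j'))
      centre-and-leaves-injective {suc j} {zero}   eq = contradiction eq (proj₂ (good-leaf j))
      centre-and-leaves-injective {suc j} {suc j'} eq = cong suc (leaf-injective eq)

      h : Fin r × Fin 2 → Triple n
      h (j , k) = chosenEdge (proj₁ (good-leaf j)) k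

      h∈chosen : ∀ j k → h (j , k) ∈ chosen (leaf j)
      h∈chosen j = chosenEdge-∈ (proj₁ (good-leaf j))

      h-injective : Injective _≡_ _≡_ h
      h-injective {j , k} {j' , k'} eq with j ≟ j'
      ... | yes refl = cong (j ,_) (chosenEdge-injective (proj₁ (good-leaf j)) eq)
      ... | no  j≢j' = contradiction (lose (h∈chosen j k) (subst (_∈ chosen (leaf j')) (sym eq) (h∈chosen j' k')))
                                     (independent-leaves j≢j')

      h∈H : ∀ jk → h jk ∈ edges H
      h∈H (j , k) = proj₁ (chosen⊆edges (h∈chosen j k))

      ends∈h : ∀ j k → (v ∈ₜ h (j , k)) × (leaf j ∈ₜ h (j , k))
      ends∈h j k = proj₂ (chosen⊆edges (h∈chosen j k))

    no-star⇒few-neighbours : ∀ {r} → ¬ ContainsBerge2Star r H → length (neighbours v) < 3 * r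
    no-star⇒few-neighbours {r} no-star
      with large-independent-subset Conflict? Conflict-sym conflicts≤2 (neighbours v)
             (all-filter (Good? v) (allFin n)) (filter⁺ (Good? v) (allFin⁺ n))
    ... | S , independent , S⊆ , neighbours≤S =
      ≰⇒> λ 3r≤ → no-star (independent-neighbours⇒star r S independent
        (All.tabulate (proj₂ ∘ ∈-filter⁻ (Good? v) {xs = allFin n} ∘ S⊆))
        (*-cancelˡ-≤ 3 (≤-trans 3r≤ neighbours≤S)))

  assemble : Fin 3 → Fin n → Fin n → Fin n → Triple n
  assemble 0F w x y = w , x , y
  assemble 1F w x y = x , w , y
  assemble 2F w x y = x , y , w

  -- Among the three pairs of a triple two are heavy or two are light, and any two of its pairs meet in a vertex w.
  data Shape (e : Triple n) : Set where
    heavy-at : ∀ tag {w x y} → Good w x → Good w y → e ≡ assemble tag w x y → Shape e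
    light-at : ∀ {w x y} → w ≢ x → w ≢ y → x ≢ y →
      LightPairOf e (w , x) → LightPairOf e (w , y) → Shape e

  shape : ∀ {a b c} → Increasing (a , b , c) → Shape (a , b , c)
  shape {a} {b} {c} increasing with Increasing⇒distinct increasing | Good? a b | Good? a c | Good? b c
  ... | _               | yes ab | yes ac | _      = heavy-at 0F ab ac refl
  ... | _               | yes ab | no _   | yes bc = heavy-at 1F (Good-sym ab) bc refl
  ... | _               | no _   | yes ac | yes bc = heavy-at 2F (Good-sym ac) (Good-sym bc) refl
  ... | a≢b , a≢c , b≢c | yes _  | no ¬ac | no ¬bc =
    light-at (≢-sym a≢c) (≢-sym b≢c) a≢b
      (LightPairOf-swap (¬Good⇒¬Heavy (≢-sym a≢c) ¬ac , ∈₁ , ∈₃))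
      (LightPairOf-swap (¬Good⇒¬Heavy (≢-sym b≢c) ¬bc , ∈₂ , ∈₃))
  ... | a≢b , a≢c , b≢c | no ¬ab | yes _  | no ¬bc =
    light-at (≢-sym a≢b) b≢c a≢c
      (LightPairOf-swap (¬Good⇒¬Heavy (≢-sym a≢b) ¬ab , ∈₁ , ∈₂))
      (¬Good⇒¬Heavy (≢-sym b≢c) ¬bc , ∈₂ , ∈₃)
  ... | a≢b , a≢c , b≢c | no ¬ab | no ¬ac | _      =
    light-at a≢b a≢c b≢c
      (¬Good⇒¬Heavy (≢-sym a≢b) ¬ab , ∈₁ , ∈₂)
      (¬Good⇒¬Heavy (≢-sym a≢c) ¬ac , ∈₁ , ∈₃)

  module _ {K : ℕ} (neighbours≤K : ∀ v → length (neighbours v) ≤ K) where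

    rank : ∀ {v u} → Good v u → Fin K
    rank {v} {u} vu-good = inject≤ (Any.index (∈-filter⁺ (Good? v) (∈-allFin u) vu-good)) (neighbours≤K v)

    rank-injective : ∀ {v x y} (vx-good : Good v x) (vy-good : Good v y) → rank vx-good ≡ rank vy-good → x ≡ y
    rank-injective _ _ = index-injective (setoid (Fin n)) _ _ ∘ inject≤-injective _ _ _ _

    Code : Set
    Code = (Fin n × Fin n) ⊎ (Fin n × Fin 3 × Fin K × Fin K × Fin 4)

    Code↔Fin : Code ↔ Fin (n * n + n * (3 * (K * (K * 4))))
    Code↔Fin = ↔-sym (↔-trans +↔⊎ (*↔× ⊎-↔ ↔-trans *↔× (↔-refl ×-↔ ↔-trans *↔× (↔-refl ×-↔
                      ↔-trans *↔× (↔-refl ×-↔ *↔×)))))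

    orient : Fin n → Fin n → Fin n → Fin 4 → Fin n × Fin n
    orient w x y 0F = w , x
    orient w x y 1F = x , w
    orient w x y 2F = w , y
    orient w x y 3F = y , w

    orient-injective : ∀ {w x y} → w ≢ x → w ≢ y → x ≢ y → Injective _≡_ _≡_ (orient w x y)
    orient-injective w≢x w≢y x≢y {0F} {0F} _  = refl
    orient-injective w≢x w≢y x≢y {0F} {1F} eq = contradiction (cong proj₁ eq) w≢x
    orient-injective w≢x w≢y x≢y {0F} {2F} eq = contradiction (cong proj₂ eq) x≢y
    orient-injective w≢x w≢y x≢y {0F} {3F} eq = contradiction (cong proj₁ eq) w≢y
    orient-injective w≢x w≢y x≢y {1F} {0F} eq = contradiction (cong proj₂ eq) w≢x
    orient-injective w≢x w≢y x≢y {1F} {1F} _  = refl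
    orient-injective w≢x w≢y x≢y {1F} {2F} eq = contradiction (cong proj₂ eq) w≢y
    orient-injective w≢x w≢y x≢y {1F} {3F} eq = contradiction (cong proj₁ eq) x≢y
    orient-injective w≢x w≢y x≢y {2F} {0F} eq = contradiction (cong proj₂ eq) (≢-sym x≢y)
    orient-injective w≢x w≢y x≢y {2F} {1F} eq = contradiction (cong proj₁ eq) w≢x
    orient-injective w≢x w≢y x≢y {2F} {2F} _  = refl
    orient-injective w≢x w≢y x≢y {2F} {3F} eq = contradiction (cong proj₁ eq) w≢y
    orient-injective w≢x w≢y x≢y {3F} {0F} eq = contradiction (cong proj₂ eq) w≢x
    orient-injective w≢x w≢y x≢y {3F} {1F} eq = contradiction (cong proj₁ eq) (≢-sym x≢y)
    orient-injective w≢x w≢y x≢y {3F} {2F} eq = contradiction (cong proj₂ eq) w≢y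
    orient-injective w≢x w≢y x≢y {3F} {3F} _  = refl

    code : ∀ {e} → Shape e → Fin 4 → Code
    code (heavy-at tag {w} wx-good wy-good _) i = inj₂ (w , tag , rank wx-good , rank wy-good , i)
    code (light-at {w} {x} {y} _ _ _ _ _)     i = inj₁ (orient w x y i)

    orient-light : ∀ {e w x y} → LightPairOf e (w , x) → LightPairOf e (w , y) →
      ∀ i → LightPairOf e (orient w x y i)
    orient-light wx _  0F = wx
    orient-light wx _  1F = LightPairOf-swap wx
    orient-light _  wy 2F = wy
    orient-light _  wy 3F = LightPairOf-swap wy

    heavy-code-injective : ∀ {w t ρ σ i w' t' ρ' σ' i'} →
      (Code ∋ inj₂ (w , t , ρ , σ , i)) ≡ inj₂ (w' , t' , ρ' , σ' , i') →
      w ≡ w' × t ≡ t' × ρ ≡ ρ' × σ ≡ σ' × i ≡ i'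
    heavy-code-injective refl = refl , refl , refl , refl , refl

    code-determines-edge : ∀ {e e'} → e ∈ edges H → e' ∈ edges H → (σ : Shape e) (σ' : Shape e') →
      ∀ {i i'} → code σ i ≡ code σ' i' → e ≡ e'
    code-determines-edge _ _ (heavy-at _ wx wy refl) (heavy-at _ wx' wy' refl) eq
      with heavy-code-injective eq
    ... | refl , refl , ρ≡ρ' , σ≡σ' , _
      with rank-injective wx wx' ρ≡ρ' | rank-injective wy wy' σ≡σ'
    ... | refl | refl = refl
    code-determines-edge e∈H e'∈H (light-at _ _ _ wx wy) (light-at _ _ _ wx' wy') {i} {i'} eq =
      light-pair-determines-edge e∈H e'∈H (orient-light wx wy i)
        (subst (LightPairOf _) (sym (inj₁-injective eq)) (orient-light wx' wy' i'))

    code-injective : ∀ {e} (σ : Shape e) → Injective _≡_ _≡_ (code σ)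
    code-injective (heavy-at _ _ _ _) eq = proj₂ (proj₂ (proj₂ (proj₂ (heavy-code-injective eq))))
    code-injective (light-at w≢x w≢y x≢y _ _) eq = orient-injective w≢x w≢y x≢y (inj₁-injective eq)

    length-edges*4≤ : length (edges H) * 4 ≤ n * n + n * (3 * (K * (K * 4)))
    length-edges*4≤ =
      injective⇒≤ (Injection.injective (↔⇒↣ Code↔Fin ↣-∘ (mk↣ encode-injective ↣-∘ ↔⇒↣ *↔×)))
      where
      edge-shape : ∀ x → Shape (lookup (edges H) x)
      edge-shape x = shape (All.lookup (canonical H) (∈-lookup x))

      encode : Fin (length (edges H)) × Fin 4 → Code
      encode (x , i) = code (edge-shape x) i

      encode-injective : Injective _≡_ _≡_ encode
      encode-injective {x , i} {y , j} eq
        with Unique-lookup-injective (distinct H)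
               (code-determines-edge (∈-lookup x) (∈-lookup y) (edge-shape x) (edge-shape y) eq)
      ... | refl = cong (x ,_) (code-injective (edge-shape x) eq)

count⇒density : ∀ k c n L → L * 4 ≤ n * n + n * c → k * c ≤ n → 4 * k * L ≤ (k + 1) * (n * n)
count⇒density k c n L 4L≤ kc≤n = begin
  4 * k * L                   ≡⟨ solve 2 (λ k L → con 4 :* k :* L := k :* (L :* con 4)) refl k L ⟩
  k * (L * 4)                 ≤⟨ *-monoʳ-≤ k 4L≤ ⟩
  k * (n * n + n * c)         ≡⟨ solve 3 (λ k c n → k :* (n :* n :+ n :* c) := k :* (n :* n) :+ k :* c :* n) refl k c n ⟩
  k * (n * n) + k * c * n     ≤⟨ +-monoʳ-≤ (k * (n * n)) (*-monoˡ-≤ n kc≤n) ⟩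
  k * (n * n) + n * n         ≡⟨ solve 2 (λ k n → k :* (n :* n) :+ n :* n := (k :+ con 1) :* (n :* n)) refl k n ⟩
  (k + 1) * (n * n)           ∎
  where
  open ≤-Reasoning
  open +-*-Solver

-- The bound holds for every r and k.
lemma2 : ∀ (r : ℕ) → 2 ≤ r → ∀ (k : ℕ) → 1 ≤ k →
    ∃[ N ] (∀ (n : ℕ) → N ≤ n → ∀ (H : Hypergraph3 n) →
      ¬ ContainsBerge2Star r H →
      4 * k * length (edges H) ≤ (k + 1) * (n * n))
lemma2 r _ k _ = k * c , λ n kc≤n H no-star →
  count⇒density k c n (length (edges H))
    (length-edges*4≤ H (λ v → <⇒≤ (no-star⇒few-neighbours H v no-star))) kc≤n
  where
  c : ℕ
  c = 3 * (3 * r * (3 * r * 4))
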